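{- Let $\mathcal{C}$ be a context schema and let $G$ and $G'$ be context expressions such that $G\lhd_{\mathcal{C}}G'$ is derivable. Let $x{:}A$ be an assignment in a block declaration in $\mathcal{C}$. Then $G|_A=G'|_A$.
   Context: Canonical LF over a fixed well-formed signature $\Sigma$: types $A ::= P\mid\Pi x{:}A.B$, $P ::= a\mid P\,M$, terms $M ::= R\mid\lambda x.M$, $R ::= c\mid x\mid R\,M$. Nominal constants $n$ may appear in types and terms like constants. Context expressions (here without context variables): $G ::= \cdot\mid G,n{:}A$. Block declarations $\Delta ::= \cdot\mid\Delta,y{:}A$; block schemas $\{x_1{:}\alpha_1,\ldots,x_n{:}\alpha_n\}\Delta$ ($\alpha_i$ arity types); a context schema $\mathcal{C}$ is a finite list of block schemas. Subordination. $\mathrm{head}(a\,M_1\cdots M_n)=a$, $\mathrm{head}(\Pi x{:}A.B)=\mathrm{head}(B)$. $\preceq$ is the least reflexive transitive relation on type constants of $\Sigma$ such that $\mathrm{head}(A_i)\preceq a$ for each declaration $a:\Pi x_1{:}A_1\ldots\Pi x_n{:}A_n.\mathrm{Type}$ and $\mathrm{head}(A_i)\preceq\mathrm{head}(A)$ for each declaration $c:\Pi x_1{:}A_1\ldots\Pi x_n{:}A_n.A$; on types (possibly containing variables or nominal constants) $A\preceq B$ iff $\mathrm{head}(A)\preceq\mathrm{head}(B)$. Context minimization: $G|_A$ is obtained from $G$ by deleting every binding $n{:}B$ with $B\not\preceq A$. Pruning. $\Delta\lhd_{\mathcal{C}}\Delta'$ is the least relation with $\cdot\lhd_{\mathcal{C}}\cdot$;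 $\Delta,x{:}A\lhd_{\mathcal{C}}\Delta',x{:}A$ if $\Delta\lhd_{\mathcal{C}}\Delta'$; $\Delta\lhd_{\mathcal{C}}\Delta',x{:}A$ if $\Delta\lhd_{\mathcal{C}}\Delta'$ and $A\not\preceq A'$ for every $A'$ such that a binding $y{:}A'$ appears in a block declaration of $\mathcal{C}$. The same rules with bindings $n{:}A$ define $G\lhd_{\mathcal{C}}G'$ for context expressions. -}

module Defs where

open import Data.Nat using (ℕ)
open import Data.Product using (Σ; ∃; _×_; _,_)
open import Data.List using (List; []; _∷_)
open import Data.List.Membership.Propositional using (_∈_)
open import Relation.Binary.PropositionalEquality using (_≡_)
open import Relation.Binary.Construct.Closure.ReflexiveTransitive using (Star)
open import Relation.Binary using (Decidable)
open import Relation.Nullary using (¬_; yes; no)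

Var : Set
Var = ℕ

Nom : Set
Nom = ℕ

-- Canonical LF syntax, over a set TC of type constants and a set OC of
-- object constants.
module Syntax (TC OC : Set) where

  mutual
    data Ty : Set where
      base : BTy → Ty
      pi   : Var → Ty → Ty → Ty

    data BTy : Set where
      tconst : TC → BTy
      tapp   : BTy → Tm → BTy

    data Tm : Set where
      root : Rt → Tm
      lam  : Var → Tm → Tm

    data Rt : Set where
      oconst : OC → Rt
      var    : Var → Rt
      nom    : Nom → Rt
      rapp   : Rt → Tm → Rt

  data Kind : Set where
    type : Kind
    kpi  : Var → Ty → Kind → Kind

  data Decl : Set where
    tyDecl  : TC → Kind → Decl
    objDecl : OC → Ty → Decl

  Signature : Set
  Signature = List Decl

  headB : BTy → TC
  headB (tconst a) = a
  headB (tapp P M) = headB P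

  head : Ty → TC
  head (base P)   = headB P
  head (pi x A B) = head B

  kindArgs : Kind → List Ty
  kindArgs type        = []
  kindArgs (kpi x A K) = A ∷ kindArgs K

  piArgs : Ty → List Ty
  piArgs (base P)   = []
  piArgs (pi x A B) = A ∷ piArgs B

  data Gen (Sig : Signature) : TC → TC → Set where
    fromKind : ∀ {a K A} → tyDecl a K ∈ Sig → A ∈ kindArgs K →
               Gen Sig (head A) a
    fromType : ∀ {c B A} → objDecl c B ∈ Sig → A ∈ piArgs B →
               Gen Sig (head A) (head B)

  _⊢_⪯_ : Signature → TC → TC → Set
  Sig ⊢ a ⪯ b = Star (Gen Sig) a b

  _⊢_⪯ᵗ_ : Signature → Ty → Ty → Set
  Sig ⊢ A ⪯ᵗ B = Sig ⊢ head A ⪯ head B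

  data Ctx : Set where
    ·     : Ctx
    _,_∶_ : Ctx → Nom → Ty → Ctx

  data BlockDecl : Set where
    ·     : BlockDecl
    _,_∶_ : BlockDecl → Var → Ty → BlockDecl

  data Arity : Set where
    ι   : Arity
    _⇒_ : Arity → Arity → Arity

  record BlockSchema : Set where
    constructor ⟨_⟩_
    field
      params : List (Var × Arity)
      decls  : BlockDecl

  CtxSchema : Set
  CtxSchema = List BlockSchema

  data _∶_∈ᵇ_ (y : Var) (A : Ty) : BlockDecl → Set where
    here  : ∀ {Δ} → y ∶ A ∈ᵇ (Δ , y ∶ A)
    there : ∀ {Δ z B} → y ∶ A ∈ᵇ Δ → y ∶ A ∈ᵇ (Δ , z ∶ B)

  InSchema : CtxSchema → Var → Ty → Set
  InSchema 𝒞 y A = ∃ λ S → S ∈ 𝒞 × (y ∶ A ∈ᵇ BlockSchema.decls S)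

  -- Context minimization G|_A (deleting every n:B with B ⋠ A); the
  -- subordination relation is decidable for a (finite) signature, and the
  -- deletion is performed according to a decision procedure for it.
  restrict : (Sig : Signature) → Decidable (Sig ⊢_⪯_) → Ctx → Ty → Ctx
  restrict Sig dec · A = ·
  restrict Sig dec (G , n ∶ B) A with dec (head B) (head A)
  ... | yes _ = restrict Sig dec G A , n ∶ B
  ... | no  _ = restrict Sig dec G A

  data _⊢_◁[_]_ (Sig : Signature) : Ctx → CtxSchema → Ctx → Set where
    ◁-nil  : ∀ {𝒞} → Sig ⊢ · ◁[ 𝒞 ] ·
    ◁-keep : ∀ {𝒞 G G' n A} → Sig ⊢ G ◁[ 𝒞 ] G' →
             Sig ⊢ (G , n ∶ A) ◁[ 𝒞 ] (G' , n ∶ A)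
    ◁-drop : ∀ {𝒞 G G' n A} → Sig ⊢ G ◁[ 𝒞 ] G' →
             (∀ y A' → InSchema 𝒞 y A' → ¬ (Sig ⊢ A ⪯ᵗ A')) →
             Sig ⊢ G ◁[ 𝒞 ] (G' , n ∶ A)

module Submission where

open import Defs
open import Relation.Binary using (Decidable)
open import Relation.Binary.PropositionalEquality using (_≡_; refl; cong; sym; trans)
open import Relation.Nullary using (¬_; yes; no; contradiction)

module _ {TC OC : Set} where
  open Syntax TC OC

  module _ (Sig : Signature) (dec : Decidable (Sig ⊢_⪯_)) where

    restrict-extend-⋠ : ∀ G n B A → ¬ (Sig ⊢ B ⪯ᵗ A) →
                        restrict Sig dec (G , n ∶ B) A ≡ restrict Sig dec G A
    restrict-extend-⋠ G n B A B⋠A with dec (head B) (head A)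
    ... | yes B⪯A = contradiction B⪯A B⋠A
    ... | no  _   = refl

    restrict-extend-cong : ∀ {G G'} n B A →
                           restrict Sig dec G A ≡ restrict Sig dec G' A →
                           restrict Sig dec (G , n ∶ B) A ≡ restrict Sig dec (G' , n ∶ B) A
    restrict-extend-cong n B A eq with dec (head B) (head A)
    ... | yes _ = cong (_, n ∶ B) eq
    ... | no  _ = eq

    -- Pruning only drops bindings that no schema type subordinates, so
    -- restriction to any schema type cannot tell G and G' apart.
    ◁⇒restrict-≡ : ∀ {𝒞 G G'} → Sig ⊢ G ◁[ 𝒞 ] G' →
                   ∀ x A → InSchema 𝒞 x A →
                   restrict Sig dec G A ≡ restrict Sig dec G' A
    ◁⇒restrict-≡ ◁-nil                         x A xA∈𝒞 = refl
    ◁⇒restrict-≡ (◁-keep {n = n} {A = B} G◁G') x A xA∈𝒞 =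
      restrict-extend-cong n B A (◁⇒restrict-≡ G◁G' x A xA∈𝒞)
    ◁⇒restrict-≡ {G' = G' , n ∶ B} (◁-drop G◁G' B⋠𝒞) x A xA∈𝒞 =
      trans (◁⇒restrict-≡ G◁G' x A xA∈𝒞)
            (sym (restrict-extend-⋠ G' n B A (B⋠𝒞 x A xA∈𝒞)))

lemma4p9 : {TC OC : Set} → let open Syntax TC OC in
    (Sig : Signature) (dec : Decidable (Sig ⊢_⪯_))
    (𝒞 : CtxSchema) (G G' : Ctx) → Sig ⊢ G ◁[ 𝒞 ] G' →
    (x : Var) (A : Ty) → InSchema 𝒞 x A →
    restrict Sig dec G A ≡ restrict Sig dec G' A
lemma4p9 Sig dec 𝒞 G G' G◁G' = ◁⇒restrict-≡ Sig dec G◁G'
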